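{- If $s\Rrightarrow s'$ (one step of linear reduction between well-typed cartesian structural resource terms), then $|s'|<|s|$, where $|s|$ is the size of $s$ (number of variable occurrences, abstractions and applications in $s$). As a consequence, linear reduction is strongly normalizing.
   Context: Structural resource terms: $s::=x\mid\lambda x^f.s\mid s\vec t$ where $\vec t=\langle t_1,\dots,t_k\rangle$ is a bag (finite ordered list of terms) and $f$ is a morphism of intersection types (finite lists of resource types $a::=o\mid\vec a\multimap a$); a morphism $\langle a_1,\dots,a_n\rangle\to\langle b_1,\dots,b_m\rangle$ is $\langle\alpha;f_1,\dots,f_m\rangle$ with $\alpha:[m]\to[n]$ a function and $f_i:a_{\alpha(i)}\to b_i$ (morphisms of arrow types $g\multimap f$ are contravariant in the source list), and a permutation is such a morphism with $\alpha$ bijective and all $f_i$ identities. Typing: $x_1:\langle\rangle,\dots,x_i:\langle a\rangle,\dots,x_n:\langle\rangle\vdash x_i:a$; from $\gamma,x:\vec b\vdash s:a$, $f:\vec a\to\vec b$ infer $\gamma\vdash\lambda x^f.s:\vec a\multimap a$; from $\gamma_0\vdash s:\vec a\multimap b$, $\gamma_1\vdash_b\vec t:\vec a$ infer $\gamma_0\otimes\gamma_1\vdash s\vec t:b$ ($\otimes$ pointwise list concatenation of contexts); bags typed componentwise with contexts tensored. Terms are in η-long form (applications $s\bar t$ to sequences $\bar t=(\vec t_1\cdots\vec t_n)$ of bags, of atomic type). For a permutation $\tau$, $[\tau]\bar t$ permutes the elements of the bags accordingly. Linear substitution $s\{\vec t/x\}$ (where $x$ occurs in $s$ exactly as many times as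 $\vec t$ has elements) replaces the occurrences of $x$, ordered left to right, by the elements of $\vec t$ in order (bound-variable annotations composed with induced permutations); extended to sequences of variables and bags. Linear reduction $\Rrightarrow$ is the contextual closure (inside abstractions, either side of applications, one element of a bag or one bag of a sequence) of the rule $(\lambda\bar x^\tau.s)\bar t\Rrightarrow s\{[\tau]\bar t/\bar x\}$ for $\tau$ a permutation. -}

module Defs where

open import Data.Nat using (ℕ; zero; suc; _+_; _<_)
open import Data.Nat.Properties using (+-suc)
open import Data.Fin using (Fin; zero; suc; toℕ; splitAt; _↑ˡ_; _↑ʳ_; _≟_)
open import Data.List using (List; []; _∷_; _++_; [_]; length; lookup; mapMaybe; map)
open import Data.List.Relation.Unary.All using (All)
open import Data.Vec as V using (Vec)
import Data.Vec.Relation.Unary.All as VAll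
open import Data.Maybe using (Maybe; just; nothing)
open import Data.Product using (Σ; _×_; _,_; proj₁; proj₂)
open import Data.Sum using (inj₁; inj₂)
open import Data.Unit using (⊤; tt)
open import Data.Empty using (⊥)
open import Data.Bool using (if_then_else_)
open import Relation.Nullary using (does)
open import Relation.Binary.PropositionalEquality using (_≡_; subst)
open import Function.Definitions using (Bijective)

-- Resource types  a ::= o | a⃗ ⊸ a   (intersection types = List Ty)

data Ty : Set where
  o   : Ty
  _⊸_ : List Ty → Ty → Ty

-- A morphism ⟨a₁..aₖ⟩ → ⟨b₁..bₘ⟩ is ⟨α; f₁..fₘ⟩ with
-- α : [m] → [k]; it is represented by the list ((α 1 , f₁) ∷ … ∷ (α m , fₘ)).
-- A morphism of arrow types  g ⊸ f : (a⃗ ⊸ a) → (b⃗ ⊸ b)  has g : b⃗ → a⃗.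

data Hom : Set where
  idₒ  : Hom
  _⊸ₕ_ : {k : ℕ} → List (Fin k × Hom) → Hom → Hom

Homs : ℕ → Set
Homs k = List (Fin k × Hom)

homFun : {k : ℕ} (f : Homs k) → Fin (length f) → Fin k
homFun f i = proj₁ (lookup f i)

data HomT : Hom → Ty → Ty → Set
data HomsT (as : List Ty) : Homs (length as) → List Ty → Set

data HomT where
  idₒ : HomT idₒ o o
  arr : ∀ {as bs a b} {g : Homs (length bs)} {f : Hom} →
        HomsT bs g as → HomT f a b → HomT (g ⊸ₕ f) (as ⊸ a) (bs ⊸ b)

data HomsT as where
  []  : HomsT as [] []
  _∷_ : ∀ {i f b g bs} → HomT f (lookup as i) b → HomsT as g bs →
        HomsT as ((i , f) ∷ g) (b ∷ bs)

data IsIdH : Hom → Set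
IsIdHs : {k : ℕ} → Homs k → Set

data IsIdH where
  idₒ : IsIdH idₒ
  arr : ∀ {k} {g : Homs k} {f} → IsIdHs g → IsIdH f → IsIdH (g ⊸ₕ f)

IsIdHs {k} g =
  (length g ≡ k) × ((i : Fin (length g)) → toℕ (homFun g i) ≡ toℕ i) ×
  All (λ p → IsIdH (proj₂ p)) g

IsPerm : {k : ℕ} → Homs k → Set
IsPerm f = Bijective _≡_ _≡_ (homFun f) × All (λ p → IsIdH (proj₂ p)) f

-- Structural resource terms (de Bruijn), with occurrence labels L
-- (the labels are bookkeeping used to compute induced permutations;
-- actual terms are Term n = Tm ⊤ n).
--   var i    : the variable x_i
--   lam as f s : λx^f.s  with f : as → (types of the occurrences of x in s)
--   app s ts : s t⃗  (t⃗ a bag = finite ordered list)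

data Tm (L : Set) : ℕ → Set where
  var : ∀ {n} → Fin n → L → Tm L n
  lam : ∀ {n} (as : List Ty) → Homs (length as) → Tm L (suc n) → Tm L n
  app : ∀ {n} → Tm L n → List (Tm L n) → Tm L n

Term : ℕ → Set
Term = Tm ⊤

size  : ∀ {L n} → Tm L n → ℕ
sizes : ∀ {L n} → List (Tm L n) → ℕ
size (var _ _)   = 1
size (lam _ _ s) = suc (size s)
size (app s ts)  = suc (size s + sizes ts)
sizes []       = 0
sizes (t ∷ ts) = size t + sizes ts

-- Typing.  Contexts give to each variable a list of types (one per
-- occurrence, left to right).

Ctx : ℕ → Set
Ctx n = Vec (List Ty) n

emptyC : ∀ {n} → Ctx n
emptyC {n} = V.replicate n []

single : ∀ {n} → Fin n → Ty → Ctx n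
single i a = emptyC V.[ i ]≔ [ a ]

_⊗_ : ∀ {n} → Ctx n → Ctx n → Ctx n
_⊗_ = V.zipWith _++_

data _⊢_∶_ : ∀ {n} → Ctx n → Term n → Ty → Set
data _⊢ᵇ_∶_ : ∀ {n} → Ctx n → List (Term n) → List Ty → Set

data _⊢_∶_ where
  ⊢var : ∀ {n} {i : Fin n} {a} → single i a ⊢ var i tt ∶ a
  ⊢lam : ∀ {n} {Γ : Ctx n} {as bs a} {f : Homs (length as)} {s} →
         (bs V.∷ Γ) ⊢ s ∶ a → HomsT as f bs → Γ ⊢ lam as f s ∶ (as ⊸ a)
  ⊢app : ∀ {n} {Γ₀ Γ₁ : Ctx n} {s ts as b} →
         Γ₀ ⊢ s ∶ (as ⊸ b) → Γ₁ ⊢ᵇ ts ∶ as → (Γ₀ ⊗ Γ₁) ⊢ app s ts ∶ b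

data _⊢ᵇ_∶_ where
  ⊢[] : ∀ {n} → emptyC {n} ⊢ᵇ [] ∶ []
  ⊢∷  : ∀ {n} {Γ₀ Γ₁ : Ctx n} {t ts a as} →
        Γ₀ ⊢ t ∶ a → Γ₁ ⊢ᵇ ts ∶ as → (Γ₀ ⊗ Γ₁) ⊢ᵇ (t ∷ ts) ∶ (a ∷ as)

data Long    : ∀ {n} {Γ : Ctx n} {s a} → Γ ⊢ s ∶ a → Set
data Spine   : ∀ {n} {Γ : Ctx n} {s a} → Γ ⊢ s ∶ a → Set
data LongBag : ∀ {n} {Γ : Ctx n} {ts as} → Γ ⊢ᵇ ts ∶ as → Set

data Long where
  lamL  : ∀ {n} {Γ : Ctx n} {as bs a f s} {d : (bs V.∷ Γ) ⊢ s ∶ a}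
          {h : HomsT as f bs} → Long d → Long (⊢lam d h)
  atomL : ∀ {n} {Γ : Ctx n} {s} {d : Γ ⊢ s ∶ o} → Spine d → Long d

data Spine where
  varS : ∀ {n} {i : Fin n} {a} → Spine (⊢var {i = i} {a = a})
  lamS : ∀ {n} {Γ : Ctx n} {as bs a f s} {d : (bs V.∷ Γ) ⊢ s ∶ a}
         {h : HomsT as f bs} → Long (⊢lam d h) → Spine (⊢lam d h)
  appS : ∀ {n} {Γ₀ Γ₁ : Ctx n} {s ts as b} {d : Γ₀ ⊢ s ∶ (as ⊸ b)}
         {e : Γ₁ ⊢ᵇ ts ∶ as} → Spine d → LongBag e → Spine (⊢app d e)

data LongBag where
  []  : ∀ {n} → LongBag (⊢[] {n})
  _∷_ : ∀ {n} {Γ₀ Γ₁ : Ctx n} {t ts a as} {d : Γ₀ ⊢ t ∶ a}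
        {e : Γ₁ ⊢ᵇ ts ∶ as} → Long d → LongBag e → LongBag (⊢∷ d e)

nth : ∀ {A : Set} → List A → ℕ → Maybe A
nth []       _       = nothing
nth (x ∷ xs) zero    = just x
nth (x ∷ xs) (suc k) = nth xs k

ext : ∀ {n m} → (Fin n → Fin m) → Fin (suc n) → Fin (suc m)
ext ρ zero    = zero
ext ρ (suc i) = suc (ρ i)

ren  : ∀ {L n m} → (Fin n → Fin m) → Tm L n → Tm L m
rens : ∀ {L n m} → (Fin n → Fin m) → List (Tm L n) → List (Tm L m)
ren ρ (var i l)    = var (ρ i) l
ren ρ (lam as f s) = lam as f (ren (ext ρ) s)
ren ρ (app s ts)   = app (ren ρ s) (rens ρ ts)
rens ρ []       = []
rens ρ (t ∷ ts) = ren ρ t ∷ rens ρ ts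

relabel  : ∀ {L L' n} → (L → L') → Tm L n → Tm L' n
relabels : ∀ {L L' n} → (L → L') → List (Tm L n) → List (Tm L' n)
relabel g (var i l)    = var i (g l)
relabel g (lam as f s) = lam as f (relabel g s)
relabel g (app s ts)   = app (relabel g s) (relabels g ts)
relabels g []       = []
relabels g (t ∷ ts) = relabel g t ∷ relabels g ts

num  : ∀ {L n} → Tm L n → Vec ℕ n → Tm (L × ℕ) n × Vec ℕ n
nums : ∀ {L n} → List (Tm L n) → Vec ℕ n → List (Tm (L × ℕ) n) × Vec ℕ n
num (var i l) c = var i (l , V.lookup c i) , (c V.[ i ]≔ suc (V.lookup c i))
num (lam as f s) c with num s (0 V.∷ c)
... | s' , (_ V.∷ c') = lam as f s' , c'
num (app s ts) c with num s c
... | s' , c₁ with nums ts c₁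
... | ts' , c₂ = app s' ts' , c₂
nums []       c = [] , c
nums (t ∷ ts) c with num t c
... | t' , c₁ with nums ts c₁
... | ts' , c₂ = t' ∷ ts' , c₂

number : ∀ {L n} → Tm L n → Tm (L × ℕ) n
number {n = n} s = proj₁ (num s (V.replicate n 0))

labelsOf  : ∀ {L n} → Fin n → Tm L n → List L
labelsOfs : ∀ {L n} → Fin n → List (Tm L n) → List L
labelsOf i (var j l)    = if does (i ≟ j) then [ l ] else []
labelsOf i (lam as f s) = labelsOf (suc i) s
labelsOf i (app s ts)   = labelsOf i s ++ labelsOfs i ts
labelsOfs i []       = []
labelsOfs i (t ∷ ts) = labelsOf i t ++ labelsOfs i ts

-- f ∘ σ, where σ is given by the list of old positions in new order
reorder : ∀ {k} → Homs k → List ℕ → Homs k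
reorder f σ = mapMaybe (nth f) σ

permBag : ∀ {L n k} → Homs k → List (Tm L n) → List (Tm L n)
permBag f ts = mapMaybe (λ p → nth ts (toℕ (proj₁ p))) f

-- simultaneous linear substitution for the k variables bound just outside
-- the d innermost binders: each occurrence of such a variable, taken left
-- to right, consumes the next element of its queue.
lsub  : ∀ {L k n} (d : ℕ) → Tm L (d + (k + n)) → Vec (List (Tm L n)) k →
        Maybe (Tm L (d + n) × Vec (List (Tm L n)) k)
lsubs : ∀ {L k n} (d : ℕ) → List (Tm L (d + (k + n))) → Vec (List (Tm L n)) k →
        Maybe (List (Tm L (d + n)) × Vec (List (Tm L n)) k)
lsub {k = k} {n = n} d (var i l) q with splitAt d i
... | inj₁ i' = just (var (i' ↑ˡ n) l , q)
... | inj₂ j with splitAt k j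
...   | inj₂ y = just (var (d ↑ʳ y) l , q)
...   | inj₁ x with V.lookup q x
...     | []     = nothing
...     | t ∷ ts = just (ren (d ↑ʳ_) t , (q V.[ x ]≔ ts))
lsub d (lam as f s) q with lsub (suc d) s q
... | nothing        = nothing
... | just (s' , q') = just (lam as f s' , q')
lsub d (app s ts) q with lsub d s q
... | nothing         = nothing
... | just (s' , q₁) with lsubs d ts q₁
...   | nothing          = nothing
...   | just (ts' , q₂) = just (app s' ts' , q₂)
lsubs d [] q = just ([] , q)
lsubs d (t ∷ ts) q with lsub d t q
... | nothing         = nothing
... | just (t' , q₁) with lsubs d ts q₁
...   | nothing          = nothing
...   | just (ts' , q₂) = just (t' ∷ ts' , q₂)

Annot : Set
Annot = Σ (List Ty) (λ as → Homs (length as))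

peel : ∀ {L n} (k : ℕ) → Tm L n → Maybe (Vec Annot k × Tm L (k + n))
peel zero s = just (V.[] , s)
peel {n = n} (suc k) (lam as f s) with peel k s
... | nothing       = nothing
... | just (fs , b) = just ((as , f) V.∷ fs , subst (Tm _) (+-suc k n) b)
peel (suc k) (var _ _)  = nothing
peel (suc k) (app _ _)  = nothing

unapp : ∀ {L n} → Tm L n → Tm L n × List (List (Tm L n))
unapp (app s ts) with unapp s
... | h , bs = h , (bs ++ [ ts ])
unapp (var i l)    = var i l , []
unapp (lam as f s) = lam as f s , []

NotLam : ∀ {L n} → Tm L n → Set
NotLam (lam _ _ _) = ⊥
NotLam (var _ _)   = ⊤
NotLam (app _ _)   = ⊤

-- Linear reduction:  (λx̄^τ.s) t̄ ⇛ s{[τ]t̄/x̄}  (τ permutations), closed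
-- under contexts; under λy^g the annotation g is composed with the
-- permutation of the occurrences of y induced by the reduction.

data Step : {L : Set} {n : ℕ} → Tm L n → Tm L n → Set₁
data StepBag : {L : Set} {n : ℕ} → List (Tm L n) → List (Tm L n) → Set₁

data Step where
  β   : ∀ {L n} {r s' h : Tm L n} {bs} {fs : Vec Annot (length bs)} {s} →
        unapp r ≡ (h , bs) → 0 < length bs →
        peel (length bs) h ≡ just (fs , s) → NotLam s →
        VAll.All (λ a → IsPerm (proj₂ a)) fs →
        lsub 0 s (V.reverse (V.zipWith (λ a ts → permBag (proj₂ a) ts) fs (V.fromList bs)))
          ≡ just (s' , V.replicate (length bs) []) →
        Step r s'
  ξλ  : ∀ {L n as f} {s : Tm L (suc n)} {s''} →
        Step (number s) s'' →
        Step (lam as f s)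
             (lam as (reorder f (map proj₂ (labelsOf zero s''))) (relabel proj₁ s''))
  ξl  : ∀ {L n} {s s' : Tm L n} {ts} → Step s s' → Step (app s ts) (app s' ts)
  ξr  : ∀ {L n} {s : Tm L n} {ts ts'} → StepBag ts ts' → Step (app s ts) (app s ts')

data StepBag where
  here  : ∀ {L n} {t t' : Tm L n} {ts} → Step t t' → StepBag (t ∷ ts) (t' ∷ ts)
  there : ∀ {L n} {t : Tm L n} {ts ts'} → StepBag ts ts' → StepBag (t ∷ ts) (t ∷ ts')

_⇛_ : ∀ {n} → Term n → Term n → Set₁
s ⇛ s' = Step s s'

{-# OPTIONS --safe #-}
-- In a β-step (λx̄^τ.s) t̄ ⇛ s{[τ]t̄/x̄}
-- every bag element is copied exactly once into the result, since the τ only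
-- reorder the bags and substitution is linear, and renaming does not change
-- sizes; so the result is smaller than the redex by its k ≥ 1 abstractions,
-- its k applications and the erased occurrences of x̄.  Contextual steps
-- inherit the decrease, and strong normalisation follows because < on ℕ is
-- well-founded.
module Submission where

open import Defs
open import Data.Nat using (_<_)
open import Data.Product using (_×_)
open import Induction.WellFounded using (Acc)

open import Data.Fin using (Fin; zero; suc; toℕ; splitAt; _↑ʳ_)
open import Data.Fin.Permutation using (Permutation)
open import Data.List using (List; []; _∷_; _++_; [_]; length; map)
open import Data.List.Properties using (map-++)
open import Data.Maybe using (just; nothing; maybe)
open import Data.Nat using (ℕ; zero; suc; _+_; _≤_; z≤n; s≤s)
open import Data.Nat.Induction using (<-wellFounded)
open import Data.Nat.ListAction using (sum)
open import Data.Nat.ListAction.Properties using (sum-++)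
open import Data.Nat.Properties
open import Data.Product using (_,_; proj₁; proj₂)
open import Data.Sum using (inj₁; inj₂)
open import Data.Vec as V using (Vec)
open import Data.Vec.Properties using (reverse-∷)
import Data.Vec.Relation.Unary.All as VAll
open import Function.Bundles using (mk⤖)
open import Function.Properties.Bijection using (⤖⇒↔)
open import Induction.WellFounded using (WellFounded; module Subrelation)
open import Relation.Binary.Construct.On as On using ()
open import Relation.Binary.PropositionalEquality hiding ([_])

open import Algebra.Properties.CommutativeMonoid.Sum +-0-commutativeMonoid
  using (sum-syntax; sum-permute)
open import Algebra.Properties.CommutativeSemigroup +-commutativeSemigroup
  using (x∙yz≈y∙xz; x∙yz≈xz∙y; xy∙z≈xz∙y)

size-subst : ∀ {L m m'} (eq : m ≡ m') (s : Tm L m) → size (subst (Tm L) eq s) ≡ size s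
size-subst refl s = refl

size-ren  : ∀ {L n m} (ρ : Fin n → Fin m) (t : Tm L n) → size (ren ρ t) ≡ size t
sizes-ren : ∀ {L n m} (ρ : Fin n → Fin m) (ts : List (Tm L n)) →
            sizes (rens ρ ts) ≡ sizes ts
size-ren ρ (var i l)    = refl
size-ren ρ (lam as f s) = cong suc (size-ren (ext ρ) s)
size-ren ρ (app s ts)   = cong suc (cong₂ _+_ (size-ren ρ s) (sizes-ren ρ ts))
sizes-ren ρ []       = refl
sizes-ren ρ (t ∷ ts) = cong₂ _+_ (size-ren ρ t) (sizes-ren ρ ts)

size-relabel  : ∀ {L L' n} (g : L → L') (t : Tm L n) → size (relabel g t) ≡ size t
sizes-relabel : ∀ {L L' n} (g : L → L') (ts : List (Tm L n)) →
                sizes (relabels g ts) ≡ sizes ts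
size-relabel g (var i l)    = refl
size-relabel g (lam as f s) = cong suc (size-relabel g s)
size-relabel g (app s ts)   = cong suc (cong₂ _+_ (size-relabel g s) (sizes-relabel g ts))
sizes-relabel g []       = refl
sizes-relabel g (t ∷ ts) = cong₂ _+_ (size-relabel g t) (sizes-relabel g ts)

size-num  : ∀ {L n} (s : Tm L n) (c : Vec ℕ n) → size (proj₁ (num s c)) ≡ size s
sizes-num : ∀ {L n} (ts : List (Tm L n)) (c : Vec ℕ n) →
            sizes (proj₁ (nums ts c)) ≡ sizes ts
size-num (var i l) c = refl
size-num (lam as f s) c with num s (0 V.∷ c) | size-num s (0 V.∷ c)
... | _ , (_ V.∷ _) | eq = cong suc eq
size-num (app s ts) c with num s c | size-num s c
... | _ , c₁ | eq₁ with nums ts c₁ | sizes-num ts c₁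
...   | _ , _ | eq₂ = cong suc (cong₂ _+_ eq₁ eq₂)
sizes-num [] c = refl
sizes-num (t ∷ ts) c with num t c | size-num t c
... | _ , c₁ | eq₁ with nums ts c₁ | sizes-num ts c₁
...   | _ , _ | eq₂ = cong₂ _+_ eq₁ eq₂

size-number : ∀ {L n} (s : Tm L n) → size (number s) ≡ size s
size-number s = size-num s _

queueSize : ∀ {L n k} → Vec (List (Tm L n)) k → ℕ
queueSize V.[]      = 0
queueSize (l V.∷ q) = sizes l + queueSize q

queueSize-∷ʳ : ∀ {L n k} (q : Vec (List (Tm L n)) k) l →
               queueSize (q V.∷ʳ l) ≡ queueSize q + sizes l
queueSize-∷ʳ V.[]      l = +-identityʳ (sizes l)
queueSize-∷ʳ (m V.∷ q) l =
  trans (cong (sizes m +_) (queueSize-∷ʳ q l)) (sym (+-assoc (sizes m) _ _))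

queueSize-reverse : ∀ {L n k} (q : Vec (List (Tm L n)) k) →
                    queueSize (V.reverse q) ≡ queueSize q
queueSize-reverse V.[]      = refl
queueSize-reverse (l V.∷ q) = begin
  queueSize (V.reverse (l V.∷ q))     ≡⟨ cong queueSize (reverse-∷ l q) ⟩
  queueSize (V.reverse q V.∷ʳ l)      ≡⟨ queueSize-∷ʳ (V.reverse q) l ⟩
  queueSize (V.reverse q) + sizes l   ≡⟨ cong (_+ sizes l) (queueSize-reverse q) ⟩
  queueSize q + sizes l               ≡⟨ +-comm (queueSize q) (sizes l) ⟩
  queueSize (l V.∷ q)                 ∎
  where open ≡-Reasoning

queueSize-pop : ∀ {L n k} (q : Vec (List (Tm L n)) k) (x : Fin k) {t ts} →
                V.lookup q x ≡ t ∷ ts → size t + queueSize (q V.[ x ]≔ ts) ≡ queueSize q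
queueSize-pop (l V.∷ q) zero    {t} {ts} refl = sym (+-assoc (size t) (sizes ts) _)
queueSize-pop (l V.∷ q) (suc x) {t} {ts} eq =
  trans (x∙yz≈y∙xz (size t) (sizes l) _) (cong (sizes l +_) (queueSize-pop q x eq))

+-mono-sequential : ∀ a a' b b' {w₀ w₁ w₂} → a' + w₁ ≤ a + w₀ → b' + w₂ ≤ b + w₁ →
                    (a' + b') + w₂ ≤ (a + b) + w₀
+-mono-sequential a a' b b' {w₀} {w₁} {w₂} a≤ b≤ = begin
  (a' + b') + w₂  ≡⟨ +-assoc a' b' w₂ ⟩
  a' + (b' + w₂)  ≤⟨ +-monoʳ-≤ a' b≤ ⟩
  a' + (b + w₁)   ≡⟨ x∙yz≈xz∙y a' b w₁ ⟩
  (a' + w₁) + b   ≤⟨ +-monoˡ-≤ b a≤ ⟩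
  (a + w₀) + b    ≡⟨ xy∙z≈xz∙y a w₀ b ⟩
  (a + b) + w₀    ∎
  where open ≤-Reasoning

lsub-size  : ∀ {L k n} d (s : Tm L (d + (k + n))) (q : Vec (List (Tm L n)) k) {s' q'} →
             lsub d s q ≡ just (s' , q') →
             size s' + queueSize q' ≤ size s + queueSize q
lsubs-size : ∀ {L k n} d (ss : List (Tm L (d + (k + n)))) (q : Vec (List (Tm L n)) k)
             {ss' q'} → lsubs d ss q ≡ just (ss' , q') →
             sizes ss' + queueSize q' ≤ sizes ss + queueSize q
lsub-size {k = k} d (var i l) q eq with splitAt d i
lsub-size d (var i l) q refl | inj₁ _ = ≤-refl
... | inj₂ j with splitAt k j
lsub-size d (var i l) q refl | inj₂ _ | inj₂ _ = ≤-refl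
... | inj₁ x with V.lookup q x in head
lsub-size d (var i l) q ()   | inj₂ _ | inj₁ _ | []
lsub-size d (var i l) q refl | inj₂ _ | inj₁ x | t ∷ ts = m≤n⇒m≤1+n (≤-reflexive (begin
  size (ren (d ↑ʳ_) t) + queueSize (q V.[ x ]≔ ts) ≡⟨ cong (_+ _) (size-ren (d ↑ʳ_) t) ⟩
  size t + queueSize (q V.[ x ]≔ ts)               ≡⟨ queueSize-pop q x head ⟩
  queueSize q                                      ∎))
  where open ≡-Reasoning
lsub-size d (lam as f s) q eq with lsub (suc d) s q in eqₛ
lsub-size d (lam as f s) q ()   | nothing
lsub-size d (lam as f s) q refl | just _ = s≤s (lsub-size (suc d) s q eqₛ)
lsub-size d (app s ts) q eq with lsub d s q in eqₛ
lsub-size d (app s ts) q () | nothing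
... | just (_ , q₁) with lsubs d ts q₁ in eqₜ
lsub-size d (app s ts) q ()   | just _ | nothing
lsub-size d (app s ts) q refl | just (s' , _) | just (ts' , _) =
  s≤s (+-mono-sequential (size s) (size s') (sizes ts) (sizes ts')
        (lsub-size d s q eqₛ) (lsubs-size d ts _ eqₜ))
lsubs-size d [] q refl = ≤-refl
lsubs-size d (t ∷ ts) q eq with lsub d t q in eqₛ
lsubs-size d (t ∷ ts) q () | nothing
... | just (_ , q₁) with lsubs d ts q₁ in eqₜ
lsubs-size d (t ∷ ts) q ()   | just _ | nothing
lsubs-size d (t ∷ ts) q refl | just (t' , _) | just (ts' , _) =
  +-mono-sequential (size t) (size t') (sizes ts) (sizes ts')
    (lsub-size d t q eqₛ) (lsubs-size d ts _ eqₜ)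

-- Positions past the end of the bag count 0: nothing ties the codomain size k
-- of a permutation to the length of the bag it acts on, hence only ≤ below.
sizeAt : ∀ {L n} → List (Tm L n) → ℕ → ℕ
sizeAt ts i = maybe size 0 (nth ts i)

sizes-permBag : ∀ {L n k} (f : Homs k) (ts : List (Tm L n)) →
                sizes (permBag f ts) ≡ ∑[ i < length f ] sizeAt ts (toℕ (homFun f i))
sizes-permBag []            ts = refl
sizes-permBag ((j , _) ∷ f) ts with nth ts (toℕ j)
... | just t  = cong (size t +_) (sizes-permBag f ts)
... | nothing = sizes-permBag f ts

sum-sizeAt-≤ : ∀ {L n} k (ts : List (Tm L n)) → ∑[ j < k ] sizeAt ts (toℕ j) ≤ sizes ts
sum-sizeAt-≤ zero    ts = z≤n
sum-sizeAt-≤ {L} {n} (suc k) [] = sum-sizeAt-≤ {L} {n} k []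
sum-sizeAt-≤ (suc k) (t ∷ ts)   = +-monoʳ-≤ (size t) (sum-sizeAt-≤ k ts)

sizes-permBag-≤ : ∀ {L n k} (f : Homs k) (ts : List (Tm L n)) → IsPerm f →
                  sizes (permBag f ts) ≤ sizes ts
sizes-permBag-≤ {k = k} f ts (α-bijective , _) = begin
  sizes (permBag f ts)                        ≡⟨ sizes-permBag f ts ⟩
  ∑[ i < length f ] sizeAtFin (homFun f i)    ≡⟨ sum-permute sizeAtFin α ⟨
  ∑[ j < k ] sizeAtFin j                      ≤⟨ sum-sizeAt-≤ k ts ⟩
  sizes ts                                    ∎
  where
  open ≤-Reasoning
  sizeAtFin : Fin k → ℕ
  sizeAtFin j = sizeAt ts (toℕ j)
  α : Permutation (length f) k
  α = ⤖⇒↔ (mk⤖ α-bijective)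

bagsSize : ∀ {L n} → List (List (Tm L n)) → ℕ
bagsSize bs = sum (map sizes bs)

permutedBags : ∀ {L n} (bs : List (List (Tm L n))) → Vec Annot (length bs) →
               Vec (List (Tm L n)) (length bs)
permutedBags bs fs = V.zipWith (λ a ts → permBag (proj₂ a) ts) fs (V.fromList bs)

queueSize-permutedBags : ∀ {L n} (bs : List (List (Tm L n))) (fs : Vec Annot (length bs)) →
                         VAll.All (λ a → IsPerm (proj₂ a)) fs →
                         queueSize (permutedBags bs fs) ≤ bagsSize bs
queueSize-permutedBags []       V.[]       VAll.[]       = z≤n
queueSize-permutedBags (b ∷ bs) (a V.∷ fs) (p VAll.∷ ps) =
  +-mono-≤ (sizes-permBag-≤ (proj₂ a) b p) (queueSize-permutedBags bs fs ps)

size-unapp : ∀ {L n} (r : Tm L n) {h bs} → unapp r ≡ (h , bs) →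
             size h + bagsSize bs ≤ size r
size-unapp (var i l)    refl = m≤m+n 1 0
size-unapp (lam as f s) refl = ≤-reflexive (+-identityʳ _)
size-unapp (app s ts) eq with unapp s in eqₛ
size-unapp (app s ts) refl | h , bs = begin
  size h + bagsSize (bs ++ [ ts ])      ≡⟨ cong (size h +_) bagsSize-snoc ⟩
  size h + (bagsSize bs + sizes ts)     ≡⟨ +-assoc (size h) _ _ ⟨
  (size h + bagsSize bs) + sizes ts     ≤⟨ +-monoˡ-≤ (sizes ts) (size-unapp s eqₛ) ⟩
  size s + sizes ts                     <⟨ n<1+n _ ⟩
  size (app s ts)                       ∎
  where
  open ≤-Reasoning
  bagsSize-snoc : bagsSize (bs ++ [ ts ]) ≡ bagsSize bs + sizes ts
  bagsSize-snoc = begin-equality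
    sum (map sizes (bs ++ [ ts ]))         ≡⟨ cong sum (map-++ sizes bs [ ts ]) ⟩
    sum (map sizes bs ++ [ sizes ts ])     ≡⟨ sum-++ (map sizes bs) [ sizes ts ] ⟩
    bagsSize bs + (sizes ts + 0)           ≡⟨ cong (bagsSize bs +_) (+-identityʳ (sizes ts)) ⟩
    bagsSize bs + sizes ts                 ∎

size-peel : ∀ {L n} k (h : Tm L n) {fs s} → peel k h ≡ just (fs , s) → size h ≡ k + size s
size-peel zero    h            refl = refl
size-peel (suc k) (lam as f s) eq with peel k s in eqₛ
size-peel (suc k) (lam as f s) ()   | nothing
size-peel {n = n} (suc k) (lam as f s) refl | just (_ , b) =
  cong suc (trans (size-peel k s eqₛ) (cong (k +_) (sym (size-subst (+-suc k n) b))))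
size-peel (suc k) (var _ _) ()
size-peel (suc k) (app _ _) ()

size-contract : ∀ {L n} {r s' h : Tm L n} {bs} {fs : Vec Annot (length bs)} {s} →
  unapp r ≡ (h , bs) → 0 < length bs → peel (length bs) h ≡ just (fs , s) →
  VAll.All (λ a → IsPerm (proj₂ a)) fs →
  lsub 0 s (V.reverse (permutedBags bs fs)) ≡ just (s' , V.replicate (length bs) []) →
  size s' < size r
size-contract {L} {n} {r} {s'} {h} {bs} {fs} {s} split nonempty peeled perms substituted =
  begin-strict
  size s'                                  ≤⟨ m≤m+n (size s') _ ⟩
  size s' + queueSize (V.replicate k [])   ≤⟨ lsub-size 0 s _ substituted ⟩
  size s + queueSize (V.reverse q)         ≡⟨ cong (size s +_) (queueSize-reverse q) ⟩
  size s + queueSize q                     ≤⟨ +-monoʳ-≤ (size s) bags≤ ⟩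
  size s + bagsSize bs                     <⟨ +-monoˡ-< (bagsSize bs) size-s<size-h ⟩
  size h + bagsSize bs                     ≤⟨ size-unapp r split ⟩
  size r                                   ∎
  where
  open ≤-Reasoning
  k : ℕ
  k = length bs
  q : Vec (List (Tm L n)) k
  q = permutedBags bs fs
  bags≤ : queueSize q ≤ bagsSize bs
  bags≤ = queueSize-permutedBags bs fs perms
  size-s<size-h : size s < size h
  size-s<size-h = subst (size s <_) (sym (size-peel k h peeled)) (m<n+m (size s) nonempty)

size-decreases  : ∀ {L n} {s s' : Tm L n} → Step s s' → size s' < size s
sizes-decreases : ∀ {L n} {ts ts' : List (Tm L n)} → StepBag ts ts' → sizes ts' < sizes ts
size-decreases (β split nonempty peeled _ perms substituted) =
  size-contract split nonempty peeled perms substituted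
size-decreases (ξλ {s = s} {s''} step) =
  s≤s (subst₂ _<_ (sym (size-relabel proj₁ s'')) (size-number s) (size-decreases step))
size-decreases (ξl step)             = s≤s (+-monoˡ-< _ (size-decreases step))
size-decreases (ξr {s = s} step)     = s≤s (+-monoʳ-< (size s) (sizes-decreases step))
sizes-decreases (here step)          = +-monoˡ-< _ (size-decreases step)
sizes-decreases (there {t = t} step) = +-monoʳ-< (size t) (sizes-decreases step)

Step-wellFounded : ∀ {L n} → WellFounded (λ (t u : Tm L n) → Step u t)
Step-wellFounded = Subrelation.wellFounded size-decreases (On.wellFounded size <-wellFounded)

mainTheorem3 : (∀ {n} {Γ : Ctx n} {s s' : Term n} {a} (d : Γ ⊢ s ∶ a) → Long d →
    s ⇛ s' → size s' < size s)
    × (∀ {n} {Γ : Ctx n} {s : Term n} {a} (d : Γ ⊢ s ∶ a) → Long d →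
    Acc (λ t u → u ⇛ t) s)
mainTheorem3 = (λ _ _ → size-decreases) , (λ {_} {_} {s} _ _ → Step-wellFounded s)
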